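{- Let $3\le m<n\le 2^m$ and let $\vec K$ be an orientation of $K_{m,n}$ with bipartition $(X,Y)$, $|X|=m$, $|Y|=n$, having no full twins. Then the only automorphism of $\vec K$ fixing every vertex of $X$ is the identity. Consequently, if all vertices of $X$ have pairwise distinct in-degrees in $\vec K$, then $\vec K$ is rigid.
   Context: $K_{m,n}$ is the complete bipartite graph with parts of sizes $m$ and $n$. An orientation assigns one direction to each edge. For a vertex $u$, $N^+(u)$ is its set of out-neighbours; two vertices $u,v$ are full twins if $N^+(u)=N^+(v)$. An automorphism of an oriented graph is a permutation $\phi$ of its vertices such that $\phi(u)\phi(v)$ is an arc whenever $uv$ is an arc; the oriented graph is rigid if its only automorphism is the identity. -}

module Defs where

open import Data.Nat using (ℕ)
open import Data.Bool using (Bool; true; false; not; T)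
open import Data.Bool.Properties using (T?)
open import Data.Empty using (⊥)
open import Data.Fin using (Fin)
open import Data.Sum using (_⊎_; inj₁; inj₂)
open import Data.List using (List; length; filter; map; _++_; allFin)
open import Relation.Nullary using (Dec; no)
open import Relation.Binary.PropositionalEquality using (_≡_)
open import Function.Bundles using (_↔_; _⇔_; Inverse)

-- An orientation of K_{m,n} with parts X = Fin m and Y = Fin n:
-- o x y = true  means the edge xy is oriented x → y,
-- o x y = false means it is oriented y → x.
Orientation : ℕ → ℕ → Set
Orientation m n = Fin m → Fin n → Bool

Vertex : ℕ → ℕ → Set
Vertex m n = Fin m ⊎ Fin n

Arc : ∀ {m n} → Orientation m n → Vertex m n → Vertex m n → Set
Arc o (inj₁ x) (inj₁ x') = ⊥
Arc o (inj₁ x) (inj₂ y)  = T (o x y)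
Arc o (inj₂ y) (inj₁ x)  = T (not (o x y))
Arc o (inj₂ y) (inj₂ y') = ⊥

Arc? : ∀ {m n} (o : Orientation m n) (u v : Vertex m n) → Dec (Arc o u v)
Arc? o (inj₁ x) (inj₁ x') = no (λ ())
Arc? o (inj₁ x) (inj₂ y)  = T? (o x y)
Arc? o (inj₂ y) (inj₁ x)  = T? (not (o x y))
Arc? o (inj₂ y) (inj₂ y') = no (λ ())

FullTwins : ∀ {m n} → Orientation m n → Vertex m n → Vertex m n → Set
FullTwins o u v = ∀ w → Arc o u w ⇔ Arc o v w

NoFullTwins : ∀ {m n} → Orientation m n → Set
NoFullTwins o = ∀ u v → FullTwins o u v → u ≡ v

IsAutomorphism : ∀ {m n} → Orientation m n → (Vertex m n ↔ Vertex m n) → Set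
IsAutomorphism o φ = ∀ u v → Arc o u v → Arc o (Inverse.to φ u) (Inverse.to φ v)

Rigid : ∀ {m n} → Orientation m n → Set
Rigid o = ∀ φ → IsAutomorphism o φ → ∀ v → Inverse.to φ v ≡ v

allVertices : ∀ m n → List (Vertex m n)
allVertices m n = map inj₁ (allFin m) ++ map inj₂ (allFin n)

inDegree : ∀ {m n} → Orientation m n → Vertex m n → ℕ
inDegree {m} {n} o v = length (filter (λ w → Arc? o w v) (allVertices m n))

module Submission where

-- Let φ be an automorphism of an orientation o of K_{m,n}
-- with 0 < m < n.  Every x ∈ X is adjacent to every y ∈ Y, so φ x and φ y
-- lie on opposite sides; hence φ either preserves the two sides or swaps
-- them, and swapping would inject Y into X, impossible as m < n.  So φ
-- restricts to a map σ on X and a permutation τ of Y with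
-- o (σ x) (τ y) = o x y.
--   * If φ fixes X pointwise then y and τ y have the same out-neighbours,
--     so they are full twins and τ y = y; hence φ is the identity.
--   * The in-degree of x ∈ X is the number of y with y → x; reindexing
--     this count by τ shows that σ preserves in-degrees.  So if the
--     in-degrees on X are distinct, φ fixes X and the first point applies.  The hypotheses 3 ≤ m and n ≤ 2^m are only
-- used through 0 < m.

open import Defs
open import Data.Nat using (ℕ; zero; suc; _≤_; _<_; _^_; s≤s; z≤n)
open import Data.Nat.Properties using (+-0-commutativeMonoid; ≤-trans)
open import Data.Bool using (Bool; true; false; not; T)
open import Data.Bool.Properties using (not-involutive)
open import Data.Unit using (tt)
open import Data.Empty using (⊥-elim)
open import Data.Fin using (Fin)
import Data.Fin as Fin
open import Data.Fin.Properties using (<⇒notInjective)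
open import Data.Fin.Permutation using (Permutation; permutation; _⟨$⟩ʳ_)
open import Data.List using (List; []; _∷_; length; filter; map; _++_; tabulate; allFin)
open import Data.Product using (_×_; _,_)
open import Data.Sum using (inj₁; inj₂)
open import Data.Sum.Properties using (inj₁-injective; inj₂-injective)
open import Function using (_∘_)
open import Function.Bundles using (Inverse; _↔_; mk⇔)
open import Relation.Nullary using (Dec)
open import Relation.Binary.PropositionalEquality
  using (_≡_; refl; sym; trans; cong; subst; subst₂; module ≡-Reasoning)
open import Algebra.Properties.CommutativeMonoid.Sum +-0-commutativeMonoid
  using (sum; sum-permute; sum-cong-≗)

inX : ∀ {m n} → Vertex m n → Bool
inX (inj₁ _) = true
inX (inj₂ _) = false

arc-crosses : ∀ {m n} (o : Orientation m n) u v → Arc o u v → inX u ≡ not (inX v)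
arc-crosses o (inj₁ x) (inj₂ y) _ = refl
arc-crosses o (inj₂ y) (inj₁ x) _ = refl

toX : ∀ {m n} (v : Vertex m n) → inX v ≡ true → Fin m
toX (inj₁ x) _ = x

inj₁-toX : ∀ {m n} (v : Vertex m n) (p : inX v ≡ true) → inj₁ (toX v p) ≡ v
inj₁-toX (inj₁ x) _ = refl

toY : ∀ {m n} (v : Vertex m n) → inX v ≡ false → Fin n
toY (inj₂ y) _ = y

inj₂-toY : ∀ {m n} (v : Vertex m n) (p : inX v ≡ false) → inj₂ (toY v p) ≡ v
inj₂-toY (inj₂ y) _ = refl

towardsX : Bool → ℕ
towardsX true  = 0
towardsX false = 1

module InDegreeX {m n : ℕ} (o : Orientation m n) (x : Fin m) where
  pointsToX : (w : Vertex m n) → Dec (Arc o w (inj₁ x))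
  pointsToX w = Arc? o w (inj₁ x)

  fromX-contributes-nothing : ∀ (xs : List (Fin m)) rest →
    length (filter pointsToX (map inj₁ xs ++ rest)) ≡ length (filter pointsToX rest)
  fromX-contributes-nothing []       rest = refl
  fromX-contributes-nothing (_ ∷ xs) rest = fromX-contributes-nothing xs rest

  fromY-count : ∀ {k} (h : Fin k → Fin n) →
    length (filter pointsToX (map inj₂ (tabulate h))) ≡ sum (λ i → towardsX (o x (h i)))
  fromY-count {zero}  h = refl
  fromY-count {suc k} h with o x (h Fin.zero)
  ... | true  = fromY-count (h ∘ Fin.suc)
  ... | false = cong suc (fromY-count (h ∘ Fin.suc))

  inDegree-formula : inDegree o (inj₁ x) ≡ sum (λ y → towardsX (o x y))
  inDegree-formula =
    trans (fromX-contributes-nothing (allFin m) (map inj₂ (allFin n))) (fromY-count (λ y → y))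

open InDegreeX using (inDegree-formula)

inDegree-invariant : ∀ {m n} (o : Orientation m n) (π : Permutation n n) {x x' : Fin m} →
  (∀ y → o x' (π ⟨$⟩ʳ y) ≡ o x y) → inDegree o (inj₁ x') ≡ inDegree o (inj₁ x)
inDegree-invariant o π {x} {x'} agree = begin
  inDegree o (inj₁ x')                   ≡⟨ inDegree-formula o x' ⟩
  sum (λ y → towardsX (o x' y))          ≡⟨ sum-permute _ π ⟩
  sum (λ y → towardsX (o x' (π ⟨$⟩ʳ y))) ≡⟨ sum-cong-≗ (cong towardsX ∘ agree) ⟩
  sum (λ y → towardsX (o x y))           ≡⟨ inDegree-formula o x ⟨
  inDegree o (inj₁ x)                    ∎
  where open ≡-Reasoning

Y-twins : ∀ {m n} (o : Orientation m n) {y y' : Fin n} →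
  (∀ x → o x y ≡ o x y') → FullTwins o (inj₂ y) (inj₂ y')
Y-twins o agree (inj₁ x) = mk⇔ (subst (T ∘ not) (agree x)) (subst (T ∘ not) (sym (agree x)))
Y-twins o agree (inj₂ _) = mk⇔ (λ ()) (λ ())

module Automorphism {m n : ℕ} (o : Orientation m n)
  (φ : Vertex m n ↔ Vertex m n) (aut : IsAutomorphism o φ) where

  f g : Vertex m n → Vertex m n
  f = Inverse.to φ
  g = Inverse.from φ

  f-injective : ∀ {u v} → f u ≡ f v → u ≡ v
  f-injective {u} {v} e =
    trans (sym (Inverse.strictlyInverseʳ φ u)) (trans (cong g e) (Inverse.strictlyInverseʳ φ v))

  -- The edge xy of K_{m,n} is mapped to an edge, whose ends lie on opposite sides.
  edge-image-crosses : ∀ x y → inX (f (inj₁ x)) ≡ not (inX (f (inj₂ y)))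
  edge-image-crosses x y with o x y in e
  ... | true  = arc-crosses o _ _ (aut (inj₁ x) (inj₂ y) (subst T (sym e) tt))
  ... | false = begin
    inX (f (inj₁ x))             ≡⟨ not-involutive _ ⟨
    not (not (inX (f (inj₁ x)))) ≡⟨ cong not (arc-crosses o _ _ (aut (inj₂ y) (inj₁ x) (subst (T ∘ not) (sym e) tt))) ⟨
    not (inX (f (inj₂ y)))       ∎
    where open ≡-Reasoning

  -- If some vertex of X exists and φ maps it into Y, then φ maps all of Y
  -- into X; this injects Fin n into Fin m, contradicting m < n.
  X-to-X : m < n → ∀ x → inX (f (inj₁ x)) ≡ true
  X-to-X m<n x with inX (f (inj₁ x)) in e
  ... | true  = refl
  ... | false = ⊥-elim (<⇒notInjective {f = into-X} m<n into-X-injective)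
    where
    Y-to-X : ∀ y → inX (f (inj₂ y)) ≡ true
    Y-to-X y = trans (sym (not-involutive _)) (cong not (trans (sym (edge-image-crosses x y)) e))
    into-X : Fin n → Fin m
    into-X y = toX (f (inj₂ y)) (Y-to-X y)
    into-X-injective : ∀ {y y'} → into-X y ≡ into-X y' → y ≡ y'
    into-X-injective {y} {y'} e' = inj₂-injective (f-injective (begin
      f (inj₂ y)         ≡⟨ inj₁-toX _ (Y-to-X y) ⟨
      inj₁ (into-X y)    ≡⟨ cong inj₁ e' ⟩
      inj₁ (into-X y')   ≡⟨ inj₁-toX _ (Y-to-X y') ⟩
      f (inj₂ y')        ∎))
      where open ≡-Reasoning

  preserves-sides : 0 < m → m < n → ∀ v → inX (f v) ≡ inX v
  preserves-sides _   m<n (inj₁ x) = X-to-X m<n x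
  preserves-sides 0<m m<n (inj₂ y) =
    trans (sym (not-involutive _)) (cong not (trans (sym (edge-image-crosses x₀ y)) (X-to-X m<n x₀)))
    where x₀ = Fin.fromℕ< 0<m

  inverse-preserves-sides : 0 < m → m < n → ∀ v → inX (g v) ≡ inX v
  inverse-preserves-sides 0<m m<n v =
    trans (sym (preserves-sides 0<m m<n (g v))) (cong inX (Inverse.strictlyInverseˡ φ v))

  module Restriction (0<m : 0 < m) (m<n : m < n) where
    σ : Fin m → Fin m
    σ x = toX (f (inj₁ x)) (preserves-sides 0<m m<n (inj₁ x))

    f-on-X : ∀ x → f (inj₁ x) ≡ inj₁ (σ x)
    f-on-X x = sym (inj₁-toX _ _)

    τ τ⁻¹ : Fin n → Fin n
    τ   y = toY (f (inj₂ y)) (preserves-sides 0<m m<n (inj₂ y))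
    τ⁻¹ y = toY (g (inj₂ y)) (inverse-preserves-sides 0<m m<n (inj₂ y))

    f-on-Y : ∀ y → f (inj₂ y) ≡ inj₂ (τ y)
    f-on-Y y = sym (inj₂-toY _ _)

    g-on-Y : ∀ y → g (inj₂ y) ≡ inj₂ (τ⁻¹ y)
    g-on-Y y = sym (inj₂-toY _ _)

    τ-τ⁻¹ : ∀ y → τ (τ⁻¹ y) ≡ y
    τ-τ⁻¹ y = inj₂-injective (begin
      inj₂ (τ (τ⁻¹ y)) ≡⟨ f-on-Y _ ⟨
      f (inj₂ (τ⁻¹ y)) ≡⟨ cong f (g-on-Y y) ⟨
      f (g (inj₂ y))   ≡⟨ Inverse.strictlyInverseˡ φ _ ⟩
      inj₂ y           ∎)
      where open ≡-Reasoning

    τ⁻¹-τ : ∀ y → τ⁻¹ (τ y) ≡ y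
    τ⁻¹-τ y = inj₂-injective (begin
      inj₂ (τ⁻¹ (τ y)) ≡⟨ g-on-Y _ ⟨
      g (inj₂ (τ y))   ≡⟨ cong g (f-on-Y y) ⟨
      g (f (inj₂ y))   ≡⟨ Inverse.strictlyInverseʳ φ _ ⟩
      inj₂ y           ∎)
      where open ≡-Reasoning

    τ-permutation : Permutation n n
    τ-permutation = permutation τ τ⁻¹ τ-τ⁻¹ τ⁻¹-τ

    orientation-invariant : ∀ x y → o (σ x) (τ y) ≡ o x y
    orientation-invariant x y with o x y in e
    ... | true  = T-true (subst₂ (Arc o) (f-on-X x) (f-on-Y y) (aut (inj₁ x) (inj₂ y) (subst T (sym e) tt)))
      where
      T-true : ∀ {b} → T b → b ≡ true
      T-true {true} _ = refl
    ... | false = T-not (subst₂ (Arc o) (f-on-Y y) (f-on-X x) (aut (inj₂ y) (inj₁ x) (subst (T ∘ not) (sym e) tt)))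
      where
      T-not : ∀ {b} → T (not b) → b ≡ false
      T-not {false} _ = refl

    σ-preserves-inDegree : ∀ x → inDegree o (inj₁ (σ x)) ≡ inDegree o (inj₁ x)
    σ-preserves-inDegree x = inDegree-invariant o τ-permutation (orientation-invariant x)

    fixing-X-is-identity : NoFullTwins o → (∀ x → f (inj₁ x) ≡ inj₁ x) → ∀ v → f v ≡ v
    fixing-X-is-identity _   fix (inj₁ x) = fix x
    fixing-X-is-identity nft fix (inj₂ y) = trans (f-on-Y y) (sym (nft _ _ (Y-twins o agree)))
      where
      σ-id : ∀ x → σ x ≡ x
      σ-id x = inj₁-injective (trans (sym (f-on-X x)) (fix x))
      agree : ∀ x → o x y ≡ o x (τ y)
      agree x = sym (subst (λ x' → o x' (τ y) ≡ o x y) (σ-id x) (orientation-invariant x y))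

    distinct-inDegrees-fix-X :
      (∀ (x x' : Fin m) → inDegree o (inj₁ x) ≡ inDegree o (inj₁ x') → x ≡ x') →
      ∀ x → f (inj₁ x) ≡ inj₁ x
    distinct-inDegrees-fix-X distinct x =
      trans (f-on-X x) (cong inj₁ (distinct _ _ (σ-preserves-inDegree x)))

mainTheorem12 : (m n : ℕ) → 3 ≤ m → m < n → n ≤ 2 ^ m →
    (o : Orientation m n) → NoFullTwins o →
    ((∀ φ → IsAutomorphism o φ → (∀ x → Inverse.to φ (inj₁ x) ≡ inj₁ x) →
    ∀ v → Inverse.to φ v ≡ v)
    × ((∀ (x x' : Fin m) → inDegree o (inj₁ x) ≡ inDegree o (inj₁ x') → x ≡ x') →
    Rigid o))
mainTheorem12 m n 3≤m m<n _ o nft =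
  (λ φ aut → fixing-X-is-identity φ aut nft) ,
  (λ distinct φ aut → fixing-X-is-identity φ aut nft (distinct-inDegrees-fix-X φ aut distinct))
  where
  0<m : 0 < m
  0<m = ≤-trans (s≤s z≤n) 3≤m
  open module Restricted φ aut = Automorphism.Restriction o φ aut 0<m m<n
    using (fixing-X-is-identity; distinct-inDegrees-fix-X)
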